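{- Let $d\geq 2$ and let $x,y,z\in\mathbb{R}^d$ be distinct points. Let $\mathfrak{h}_x,\mathfrak{h}_y,\mathfrak{h}_z\subseteq\mathfrak{e}(d)$ be the Lie algebras of the stabilisers of these points. Then $x,y,z$ are collinear if and only if $\mathfrak{h}_x\subseteq\mathfrak{h}_y+\mathfrak{h}_z$.
   Context: $E(d)$ is the Euclidean group of matrices $\begin{bmatrix}A&b\\0&1\end{bmatrix}\in\mathrm{GL}(d+1,\mathbb{R})$ with $A^tA=I$, $b\in\mathbb{R}^d$, acting on $\mathbb{R}^d$ by affine maps. Its Lie algebra $\mathfrak{e}(d)$ consists of matrices $\begin{bmatrix}S&t\\0&0\end{bmatrix}$ with $S^t=-S$, $t\in\mathbb{R}^d$. The Lie algebra of the stabiliser of $q\in\mathbb{R}^d$ is $\mathfrak{h}_q=\Big\{\begin{bmatrix}S&-Sq\\0&0\end{bmatrix}: S\in\mathbb{R}^{d\times d},\ S^t=-S\Big\}$. -}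

module Defs where

open import Level using (0ℓ)
open import Data.Nat using (ℕ; zero; suc)
open import Data.Fin using (Fin; zero; suc)
open import Data.Product using (Σ; ∃; _×_; _,_)
open import Relation.Nullary using (¬_)
open import Relation.Binary.PropositionalEquality using (_≡_)
open import Relation.Binary.Structures using (IsTotalOrder)
open import Algebra.Structures using (IsCommutativeRing)

-- The real numbers, axiomatised as a complete ordered field
-- (any two such structures are isomorphic, so quantifying over all of them
-- is the same as speaking about ℝ).
record RealField : Set₁ where
  infixl 6 _+_
  infixl 7 _*_
  infix  4 _≤_
  field
    Carrier : Set
    _+_ _*_ : Carrier → Carrier → Carrier
    -_      : Carrier → Carrier
    0# 1#   : Carrier
    _≤_     : Carrier → Carrier → Set
    isCommutativeRing : IsCommutativeRing _≡_ _+_ _*_ -_ 0# 1#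
    0≢1     : ¬ (0# ≡ 1#)
    inv     : (x : Carrier) → ¬ (x ≡ 0#) → Carrier
    inv-law : (x : Carrier) (p : ¬ (x ≡ 0#)) → x * inv x p ≡ 1#
    isTotalOrder : IsTotalOrder _≡_ _≤_
    +-mono-≤ : ∀ {x y} z → x ≤ y → x + z ≤ y + z
    *-nonneg : ∀ {x y} → 0# ≤ x → 0# ≤ y → 0# ≤ x * y
    sup : (P : Carrier → Set) → (∃ λ x → P x) →
          (∃ λ b → ∀ x → P x → x ≤ b) →
          ∃ λ s → (∀ x → P x → x ≤ s) × (∀ b → (∀ x → P x → x ≤ b) → s ≤ b)

module Euclid (ℝ : RealField) where
  open RealField ℝ

  Vec : ℕ → Set
  Vec d = Fin d → Carrier

  Mat : ℕ → Set
  Mat d = Fin d → Fin d → Carrier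

  sumF : (n : ℕ) → (Fin n → Carrier) → Carrier
  sumF zero    f = 0#
  sumF (suc n) f = f zero + sumF n (λ i → f (suc i))

  _≈v_ : {d : ℕ} → Vec d → Vec d → Set
  x ≈v y = ∀ i → x i ≡ y i

  _≈m_ : {d : ℕ} → Mat d → Mat d → Set
  A ≈m B = ∀ i j → A i j ≡ B i j

  _+v_ : {d : ℕ} → Vec d → Vec d → Vec d
  (x +v y) i = x i + y i

  _·v_ : {d : ℕ} → Carrier → Vec d → Vec d
  (a ·v x) i = a * x i

  -v_ : {d : ℕ} → Vec d → Vec d
  (-v x) i = - x i

  _+m_ : {d : ℕ} → Mat d → Mat d → Mat d
  (A +m B) i j = A i j + B i j

  _⊛_ : {d : ℕ} → Mat d → Vec d → Vec d
  _⊛_ {d} A x i = sumF d (λ j → A i j * x j)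

  transpose : {d : ℕ} → Mat d → Mat d
  transpose A i j = A j i

  -m_ : {d : ℕ} → Mat d → Mat d
  (-m A) i j = - A i j

  IsSkew : {d : ℕ} → Mat d → Set
  IsSkew S = transpose S ≈m (-m S)

  -- An element [[S , t],[0 , 0]] of gl(d+1) with the bottom row zero,
  -- recorded by its blocks S and t.
  record Block (d : ℕ) : Set where
    constructor ⟦_,_⟧
    field
      blk : Mat d
      col : Vec d
  open Block public

  _≈b_ : {d : ℕ} → Block d → Block d → Set
  u ≈b v = (blk u ≈m blk v) × (col u ≈v col v)

  _+b_ : {d : ℕ} → Block d → Block d → Block d
  u +b v = ⟦ blk u +m blk v , col u +v col v ⟧

  Subspace : ℕ → Set₁
  Subspace d = Block d → Set

  𝔢 : (d : ℕ) → Subspace d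
  𝔢 d u = IsSkew (blk u)

  𝔥 : {d : ℕ} → Vec d → Subspace d
  𝔥 q u = Σ (Mat _) λ S → IsSkew S × (⟦ S , -v (S ⊛ q) ⟧ ≈b u)

  _⊕_ : {d : ℕ} → Subspace d → Subspace d → Subspace d
  (U ⊕ V) w = ∃ λ u → ∃ λ v → U u × V v × (w ≈b (u +b v))

  _⊆_ : {d : ℕ} → Subspace d → Subspace d → Set
  U ⊆ V = ∀ w → U w → V w

  Collinear : {d : ℕ} → Vec d → Vec d → Vec d → Set
  Collinear {d} x y z =
    Σ (Vec d) λ p → Σ (Vec d) λ v → Σ Carrier λ a → Σ Carrier λ b → Σ Carrier λ c →
      (x ≈v (p +v (a ·v v))) × (y ≈v (p +v (b ·v v))) × (z ≈v (p +v (c ·v v)))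

{-# OPTIONS --safe #-}
-- If x = (1 − t) y + t z, every generator (S , −S x) of 𝔥 x splits as
-- ((1 − t) S , −(1 − t) S y) + (t S , −t S z).  Conversely, put u = z − y and
-- w = x − y.  The inclusion forces ⟨u , S w⟩ = 0 for every skew S, since
-- ⟨u , S₂ u⟩ = 0 for skew S₂.  For S = e_j uᵗ − u e_jᵗ this reads
-- ⟨u , u⟩ w_j = ⟨u , w⟩ u_j, and ⟨u , u⟩ ≠ 0 because y ≠ z, so x lies on the
-- line through y and z.
module Submission where

open import Defs
open import Data.Nat using (ℕ; _≤_)
open import Data.Product using (_×_)
open import Relation.Nullary using (¬_)
open import Function.Bundles using (_⇔_)

open import Level using (0ℓ)
open import Algebra.Bundles using (CommutativeRing)
import Data.Nat as ℕ
import Data.Nat.Properties as ℕₚ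
open import Data.Integer as ℤ using (ℤ; 0ℤ; 1ℤ; -[1+_]; _⊖_; _◃_)
import Data.Integer.Properties as ℤₚ
import Data.Sign as Sign
open import Data.Fin using (Fin; zero; suc)
open import Data.Fin.Properties using (∀-cons)
open import Data.Maybe using (map)
open import Data.Product using (Σ; _,_)
open import Data.Sum using (inj₁; inj₂)
open import Function.Base using (_∘_; flip)
open import Function.Bundles using (mk⇔)
import Relation.Binary.PropositionalEquality as ≡
open import Relation.Binary.Structures using (IsTotalOrder)
open import Relation.Nullary.Decidable using (dec⇒maybe)

¬¬-pull-Fin : ∀ {p} n {P : Fin n → Set p} → (∀ i → ¬ ¬ P i) → ¬ ¬ (∀ i → P i)
¬¬-pull-Fin ℕ.zero    ¬¬P ¬∀P = ¬∀P (λ ())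
¬¬-pull-Fin (ℕ.suc n) ¬¬P ¬∀P =
  ¬¬P zero (λ P₀ → ¬¬-pull-Fin n (¬¬P ∘ suc) (λ ∀P → ¬∀P (∀-cons P₀ ∀P)))

-- Algebra.Solver.Ring with integer coefficients.  Taking the ring itself as
-- coefficients would not do: a constant such as 1# - 1# is then not
-- recognised as zero.
module IntegerCoefficients {c ℓ} (R : CommutativeRing c ℓ) where
  open CommutativeRing R
  open import Algebra.Properties.Ring ring
    using (-0#≈0#; -‿involutive; -‿distribˡ-*; -‿distribʳ-*; -‿+-comm)
  open import Algebra.Properties.Semiring.Mult.TCOptimised semiring
    using (1+×; ×-homo-+; ×1-homo-*) renaming (_×_ to _·_)
  open import Algebra.Solver.Ring.AlmostCommutativeRing
    using (fromCommutativeRing; _-Raw-AlmostCommutative⟶_; Induced-equivalence)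
  open import Relation.Binary.Definitions using (WeaklyDecidable)
  open import Relation.Binary.Reasoning.Setoid setoid

  -- The optimised multiplication makes fromℤ (+ 1) and 1# definitionally equal.
  fromℤ : ℤ → Carrier
  fromℤ (ℤ.+ n)    = n · 1#
  fromℤ -[1+ n ]   = - (ℕ.suc n · 1#)

  x-y≈[1+x]-[1+y] : ∀ x y → x - y ≈ (1# + x) - (1# + y)
  x-y≈[1+x]-[1+y] x y = begin
    x - y                   ≈⟨ +-identityˡ (x - y) ⟨
    0# + (x - y)            ≈⟨ +-congʳ (-‿inverseʳ 1#) ⟨
    (1# - 1#) + (x - y)     ≈⟨ +-assoc 1# (- 1#) (x - y) ⟩
    1# + (- 1# + (x - y))   ≈⟨ +-congˡ (+-assoc (- 1#) x (- y)) ⟨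
    1# + ((- 1# + x) - y)   ≈⟨ +-congˡ (+-congʳ (+-comm (- 1#) x)) ⟩
    1# + ((x - 1#) - y)     ≈⟨ +-congˡ (+-assoc x (- 1#) (- y)) ⟩
    1# + (x + (- 1# - y))   ≈⟨ +-assoc 1# x (- 1# - y) ⟨
    (1# + x) + (- 1# - y)   ≈⟨ +-congˡ (-‿+-comm 1# y) ⟩
    (1# + x) - (1# + y)     ∎

  fromℤ-⊖ : ∀ m n → fromℤ (m ⊖ n) ≈ m · 1# - n · 1#
  fromℤ-⊖ m         ℕ.zero    = begin
    m · 1#       ≈⟨ +-identityʳ (m · 1#) ⟨
    m · 1# + 0#  ≈⟨ +-congˡ -0#≈0# ⟨
    m · 1# - 0#  ∎
  fromℤ-⊖ ℕ.zero    (ℕ.suc n) = sym (+-identityˡ _)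
  fromℤ-⊖ (ℕ.suc m) (ℕ.suc n) = begin
    fromℤ (ℕ.suc m ⊖ ℕ.suc n)        ≡⟨ ≡.cong fromℤ (ℤₚ.[1+m]⊖[1+n]≡m⊖n m n) ⟩
    fromℤ (m ⊖ n)                    ≈⟨ fromℤ-⊖ m n ⟩
    m · 1# - n · 1#                  ≈⟨ x-y≈[1+x]-[1+y] (m · 1#) (n · 1#) ⟩
    (1# + m · 1#) - (1# + n · 1#)    ≈⟨ +-cong (1+× m 1#) (-‿cong (1+× n 1#)) ⟨
    ℕ.suc m · 1# - ℕ.suc n · 1#      ∎

  fromℤ-‿homo : ∀ i → fromℤ (ℤ.- i) ≈ - fromℤ i
  fromℤ-‿homo (ℤ.+ ℕ.zero)  = sym -0#≈0#
  fromℤ-‿homo (ℤ.+ ℕ.suc n) = refl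
  fromℤ-‿homo -[1+ n ]      = sym (-‿involutive _)

  fromℤ-+-homo : ∀ i j → fromℤ (i ℤ.+ j) ≈ fromℤ i + fromℤ j
  fromℤ-+-homo -[1+ m ] -[1+ n ] = begin
    - (ℕ.suc (ℕ.suc (m ℕ.+ n)) · 1#)     ≡⟨ ≡.cong (λ k → - (ℕ.suc k · 1#)) (ℕₚ.+-suc m n) ⟨
    - ((ℕ.suc m ℕ.+ ℕ.suc n) · 1#)       ≈⟨ -‿cong (×-homo-+ 1# (ℕ.suc m) (ℕ.suc n)) ⟩
    - (ℕ.suc m · 1# + ℕ.suc n · 1#)      ≈⟨ -‿+-comm _ _ ⟨
    - (ℕ.suc m · 1#) + - (ℕ.suc n · 1#)  ∎
  fromℤ-+-homo -[1+ m ] (ℤ.+ n)  = trans (fromℤ-⊖ n (ℕ.suc m)) (+-comm _ _)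
  fromℤ-+-homo (ℤ.+ m)  -[1+ n ] = fromℤ-⊖ m (ℕ.suc n)
  fromℤ-+-homo (ℤ.+ m)  (ℤ.+ n)  = ×-homo-+ 1# m n

  fromℤ-+◃ : ∀ n → fromℤ (Sign.+ ◃ n) ≈ n · 1#
  fromℤ-+◃ ℕ.zero    = refl
  fromℤ-+◃ (ℕ.suc n) = refl

  fromℤ--◃ : ∀ n → fromℤ (Sign.- ◃ n) ≈ - (n · 1#)
  fromℤ--◃ ℕ.zero    = sym -0#≈0#
  fromℤ--◃ (ℕ.suc n) = refl

  fromℤ-*-homo : ∀ i j → fromℤ (i ℤ.* j) ≈ fromℤ i * fromℤ j
  fromℤ-*-homo (ℤ.+ m)  (ℤ.+ n)  = trans (fromℤ-+◃ (m ℕ.* n)) (×1-homo-* m n)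
  fromℤ-*-homo (ℤ.+ m)  -[1+ n ] = begin
    fromℤ (Sign.- ◃ m ℕ.* ℕ.suc n)        ≈⟨ fromℤ--◃ (m ℕ.* ℕ.suc n) ⟩
    - ((m ℕ.* ℕ.suc n) · 1#)             ≈⟨ -‿cong (×1-homo-* m (ℕ.suc n)) ⟩
    - (m · 1# * (ℕ.suc n · 1#))          ≈⟨ -‿distribʳ-* _ _ ⟩
    m · 1# * - (ℕ.suc n · 1#)            ∎
  fromℤ-*-homo -[1+ m ] (ℤ.+ n)  = begin
    fromℤ (Sign.- ◃ ℕ.suc m ℕ.* n)        ≈⟨ fromℤ--◃ (ℕ.suc m ℕ.* n) ⟩
    - ((ℕ.suc m ℕ.* n) · 1#)             ≈⟨ -‿cong (×1-homo-* (ℕ.suc m) n) ⟩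
    - (ℕ.suc m · 1# * (n · 1#))          ≈⟨ -‿distribˡ-* _ _ ⟩
    - (ℕ.suc m · 1#) * n · 1#            ∎
  fromℤ-*-homo -[1+ m ] -[1+ n ] = begin
    fromℤ (Sign.+ ◃ ℕ.suc m ℕ.* ℕ.suc n)      ≈⟨ fromℤ-+◃ (ℕ.suc m ℕ.* ℕ.suc n) ⟩
    (ℕ.suc m ℕ.* ℕ.suc n) · 1#               ≈⟨ ×1-homo-* (ℕ.suc m) (ℕ.suc n) ⟩
    ℕ.suc m · 1# * (ℕ.suc n · 1#)            ≈⟨ -‿involutive _ ⟨
    - - (ℕ.suc m · 1# * (ℕ.suc n · 1#))      ≈⟨ -‿cong (-‿distribˡ-* _ _) ⟩
    - (- (ℕ.suc m · 1#) * (ℕ.suc n · 1#))    ≈⟨ -‿distribʳ-* _ _ ⟩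
    - (ℕ.suc m · 1#) * - (ℕ.suc n · 1#)      ∎

  fromℤ-morphism : ℤ.+-*-rawRing -Raw-AlmostCommutative⟶ fromCommutativeRing R
  fromℤ-morphism = record
    { ⟦_⟧    = fromℤ
    ; +-homo = fromℤ-+-homo
    ; *-homo = fromℤ-*-homo
    ; -‿homo = fromℤ-‿homo
    ; 0-homo = refl
    ; 1-homo = refl
    }

  fromℤ-weaklyDecidable : WeaklyDecidable (Induced-equivalence fromℤ-morphism)
  fromℤ-weaklyDecidable i j = map (reflexive ∘ ≡.cong fromℤ) (dec⇒maybe (i ℤ.≟ j))

  open import Algebra.Solver.Ring ℤ.+-*-rawRing (fromCommutativeRing R)
    fromℤ-morphism fromℤ-weaklyDecidable public
    using (solve; _:=_; con; _:+_; _:*_; :-_; _:-_)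

open ≡ using (_≡_; _≗_; refl; sym; trans; cong; cong₂; subst; subst₂; module ≡-Reasoning)

module RealFieldProperties (ℝ : RealField) where
  open RealField ℝ renaming (_≤_ to _≤ℝ_)
  private module ≤ℝ = IsTotalOrder isTotalOrder

  commutativeRing : CommutativeRing 0ℓ 0ℓ
  commutativeRing = record { isCommutativeRing = isCommutativeRing }

  open CommutativeRing commutativeRing public using (_-_; ring)
  open CommutativeRing commutativeRing
    using (semiring; +-comm; *-comm; +-identityˡ; +-identityʳ; *-identityˡ; -‿inverseʳ)
  open import Algebra.Properties.Ring ring using (-1*x≈-x)
  open import Algebra.Properties.Semiring.Sum semiring public
    using (sum; sum-cong-≗; sum-replicate-zero; ∑-distrib-+; ∑-comm; *-distribˡ-sum)
  open IntegerCoefficients commutativeRing public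
  open ≡-Reasoning

  x*y*y⁻¹≡x : ∀ x {y} (y≢0 : ¬ y ≡ 0#) → x * y * inv y y≢0 ≡ x
  x*y*y⁻¹≡x x {y} y≢0 = begin
    x * y * inv y y≢0    ≡⟨ solve 3 (λ x y y⁻¹ → x :* y :* y⁻¹ := x :* (y :* y⁻¹))
                                    refl x y (inv y y≢0) ⟩
    x * (y * inv y y≢0)  ≡⟨ cong (x *_) (inv-law y y≢0) ⟩
    x * 1#               ≡⟨ solve 1 (λ x → x :* con 1ℤ := x) refl x ⟩
    x                    ∎

  x*y≡0⇒y≡0 : ∀ {x y} → ¬ x ≡ 0# → x * y ≡ 0# → y ≡ 0#
  x*y≡0⇒y≡0 {x} {y} x≢0 xy≡0 = begin
    y                  ≡⟨ x*y*y⁻¹≡x y x≢0 ⟨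
    y * x * inv x x≢0  ≡⟨ cong (_* inv x x≢0) (trans (*-comm y x) xy≡0) ⟩
    0# * inv x x≢0     ≡⟨ solve 1 (λ z → con 0ℤ :* z := con 0ℤ) refl (inv x x≢0) ⟩
    0#                 ∎

  x*x≡0⇒¬¬x≡0 : ∀ {x} → x * x ≡ 0# → ¬ ¬ x ≡ 0#
  x*x≡0⇒¬¬x≡0 xx≡0 x≢0 = x≢0 (x*y≡0⇒y≡0 x≢0 xx≡0)

  x≡y+[x-y] : ∀ x y → x ≡ y + (x - y)
  x≡y+[x-y] = solve 2 (λ x y → x := y :+ (x :- y)) refl

  x-y≡0⇒x≡y : ∀ {x y} → x - y ≡ 0# → x ≡ y
  x-y≡0⇒x≡y {x} {y} x-y≡0 = begin
    x            ≡⟨ x≡y+[x-y] x y ⟩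
    y + (x - y)  ≡⟨ cong (y +_) x-y≡0 ⟩
    y + 0#       ≡⟨ +-identityʳ y ⟩
    y            ∎

  x≤0⇒0≤-x : ∀ {x} → x ≤ℝ 0# → 0# ≤ℝ - x
  x≤0⇒0≤-x {x} x≤0 = subst₂ _≤ℝ_ (-‿inverseʳ x) (+-identityˡ (- x)) (+-mono-≤ (- x) x≤0)

  0≤x*x : ∀ x → 0# ≤ℝ x * x
  0≤x*x x with ≤ℝ.total 0# x
  ... | inj₁ 0≤x = *-nonneg 0≤x 0≤x
  ... | inj₂ x≤0 = subst (0# ≤ℝ_) (solve 1 (λ x → :- x :* :- x := x :* x) refl x)
                         (*-nonneg (x≤0⇒0≤-x x≤0) (x≤0⇒0≤-x x≤0))

  0≤1 : 0# ≤ℝ 1#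
  0≤1 = subst (0# ≤ℝ_) (*-identityˡ 1#) (0≤x*x 1#)

  +-nonneg : ∀ {x y} → 0# ≤ℝ x → 0# ≤ℝ y → 0# ≤ℝ x + y
  +-nonneg {x} {y} 0≤x 0≤y = ≤ℝ.trans 0≤y (subst (_≤ℝ x + y) (+-identityˡ y) (+-mono-≤ y 0≤x))

  x+y≡0⇒x≡0 : ∀ {x y} → 0# ≤ℝ x → 0# ≤ℝ y → x + y ≡ 0# → x ≡ 0#
  x+y≡0⇒x≡0 {x} {y} 0≤x 0≤y x+y≡0 = ≤ℝ.antisym x≤0 0≤x
    where
    x≤0 : x ≤ℝ 0#
    x≤0 = subst₂ _≤ℝ_ (+-identityˡ x) (trans (+-comm y x) x+y≡0) (+-mono-≤ x 0≤y)

  x+y≡0⇒y≡0 : ∀ {x y} → 0# ≤ℝ x → 0# ≤ℝ y → x + y ≡ 0# → y ≡ 0#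
  x+y≡0⇒y≡0 {x} {y} 0≤x 0≤y x+y≡0 = x+y≡0⇒x≡0 0≤y 0≤x (trans (+-comm y x) x+y≡0)

  1+1≢0 : ¬ 1# + 1# ≡ 0#
  1+1≢0 1+1≡0 = 0≢1 (sym (x+y≡0⇒x≡0 0≤1 0≤1 1+1≡0))

  x≡-x⇒x≡0 : ∀ {x} → x ≡ - x → x ≡ 0#
  x≡-x⇒x≡0 {x} x≡-x = x*y≡0⇒y≡0 1+1≢0 (begin
    (1# + 1#) * x  ≡⟨ solve 1 (λ x → (con 1ℤ :+ con 1ℤ) :* x := x :+ x) refl x ⟩
    x + x          ≡⟨ cong (x +_) x≡-x ⟩
    x - x          ≡⟨ -‿inverseʳ x ⟩
    0#             ∎)

  sum-neg : ∀ {n} (f : Fin n → Carrier) → sum (λ i → - f i) ≡ - sum f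
  sum-neg f = begin
    sum (λ i → - f i)       ≡⟨ sum-cong-≗ (λ i → sym (-1*x≈-x (f i))) ⟩
    sum (λ i → - 1# * f i)  ≡⟨ *-distribˡ-sum (- 1#) f ⟨
    - 1# * sum f            ≡⟨ -1*x≈-x (sum f) ⟩
    - sum f                 ∎

  sum-nonneg : ∀ {n} {f : Fin n → Carrier} → (∀ i → 0# ≤ℝ f i) → 0# ≤ℝ sum f
  sum-nonneg {ℕ.zero}  _   = ≤ℝ.refl
  sum-nonneg {ℕ.suc n} 0≤f = +-nonneg (0≤f zero) (sum-nonneg (0≤f ∘ suc))

  sum-nonneg≡0 : ∀ {n} {f : Fin n → Carrier} →
                 (∀ i → 0# ≤ℝ f i) → sum f ≡ 0# → ∀ i → f i ≡ 0#
  sum-nonneg≡0 {ℕ.suc n} {f} 0≤f Σf≡0 =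
    ∀-cons (x+y≡0⇒x≡0 (0≤f zero) 0≤rest Σf≡0)
           (sum-nonneg≡0 (0≤f ∘ suc) (x+y≡0⇒y≡0 (0≤f zero) 0≤rest Σf≡0))
    where
    0≤rest : 0# ≤ℝ sum (f ∘ suc)
    0≤rest = sum-nonneg (0≤f ∘ suc)

module LinearAlgebra (ℝ : RealField) where
  open RealField ℝ hiding (_≤_)
  open Euclid ℝ
  open RealFieldProperties ℝ
  open CommutativeRing commutativeRing using (distribˡ; distribʳ; *-assoc; zeroˡ)
  open import Algebra.Properties.Ring ring using (-‿distribʳ-*)
  open ≡-Reasoning

  private variable d : ℕ

  _−v_ : Vec d → Vec d → Vec d
  u −v v = u +v (-v v)

  _·m_ : Carrier → Mat d → Mat d
  (c ·m M) i j = c * M i j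

  dot : Vec d → Vec d → Carrier
  dot {d} u v = sumF d (λ i → u i * v i)

  δ : Fin d → Fin d → Carrier
  δ zero    zero    = 1#
  δ zero    (suc _) = 0#
  δ (suc _) zero    = 0#
  δ (suc i) (suc j) = δ i j

  sumF≡sum : ∀ n (f : Fin n → Carrier) → sumF n f ≡ sum f
  sumF≡sum ℕ.zero    f = refl
  sumF≡sum (ℕ.suc n) f = cong (f zero +_) (sumF≡sum n (f ∘ suc))

  sumF-cong : ∀ n {f g : Fin n → Carrier} → f ≗ g → sumF n f ≡ sumF n g
  sumF-cong n f≗g = trans (sumF≡sum n _) (trans (sum-cong-≗ f≗g) (sym (sumF≡sum n _)))

  sumF-0 : ∀ n → sumF n (λ _ → 0#) ≡ 0#
  sumF-0 n = trans (sumF≡sum n _) (sum-replicate-zero n)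

  sumF-+ : ∀ n (f g : Fin n → Carrier) → sumF n (λ i → f i + g i) ≡ sumF n f + sumF n g
  sumF-+ n f g = begin
    sumF n (λ i → f i + g i)  ≡⟨ sumF≡sum n _ ⟩
    sum (λ i → f i + g i)     ≡⟨ ∑-distrib-+ f g ⟩
    sum f + sum g             ≡⟨ cong₂ _+_ (sumF≡sum n f) (sumF≡sum n g) ⟨
    sumF n f + sumF n g       ∎

  sumF-*ˡ : ∀ n c (f : Fin n → Carrier) → sumF n (λ i → c * f i) ≡ c * sumF n f
  sumF-*ˡ n c f = begin
    sumF n (λ i → c * f i)  ≡⟨ sumF≡sum n _ ⟩
    sum (λ i → c * f i)     ≡⟨ *-distribˡ-sum c f ⟨
    c * sum f               ≡⟨ cong (c *_) (sumF≡sum n f) ⟨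
    c * sumF n f            ∎

  sumF-neg : ∀ n (f : Fin n → Carrier) → sumF n (λ i → - f i) ≡ - sumF n f
  sumF-neg n f = begin
    sumF n (λ i → - f i)  ≡⟨ sumF≡sum n _ ⟩
    sum (λ i → - f i)     ≡⟨ sum-neg f ⟩
    - sum f               ≡⟨ cong -_ (sumF≡sum n f) ⟨
    - sumF n f            ∎

  sumF-comm : ∀ m n (f : Fin m → Fin n → Carrier) →
              sumF m (λ i → sumF n (f i)) ≡ sumF n (λ j → sumF m (λ i → f i j))
  sumF-comm m n f = begin
    sumF m (λ i → sumF n (f i))              ≡⟨ sumF-cong m (λ i → sumF≡sum n (f i)) ⟩
    sumF m (λ i → sum (f i))                 ≡⟨ sumF≡sum m _ ⟩
    sum (λ i → sum (f i))                    ≡⟨ ∑-comm f ⟩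
    sum (λ j → sum (λ i → f i j))            ≡⟨ sumF≡sum n _ ⟨
    sumF n (λ j → sum (λ i → f i j))         ≡⟨ sumF-cong n (λ j → sumF≡sum m _) ⟨
    sumF n (λ j → sumF m (λ i → f i j))      ∎

  sumF-linear : ∀ n a b (f g : Fin n → Carrier) →
                sumF n (λ i → a * f i - b * g i) ≡ a * sumF n f - b * sumF n g
  sumF-linear n a b f g = begin
    sumF n (λ i → a * f i - b * g i)                 ≡⟨ sumF-+ n _ _ ⟩
    sumF n (λ i → a * f i) + sumF n (λ i → - (b * g i))
      ≡⟨ cong₂ _+_ (sumF-*ˡ n a f) (trans (sumF-neg n _) (cong -_ (sumF-*ˡ n b g))) ⟩
    a * sumF n f - b * sumF n g                      ∎

  sumF-δ : ∀ n (j : Fin n) (f : Fin n → Carrier) → sumF n (λ k → δ j k * f k) ≡ f j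
  sumF-δ (ℕ.suc n) zero f = begin
    1# * f zero + sumF n (λ k → 0# * f (suc k))
      ≡⟨ cong (1# * f zero +_) (trans (sumF-cong n (zeroˡ ∘ f ∘ suc)) (sumF-0 n)) ⟩
    1# * f zero + 0#
      ≡⟨ solve 1 (λ x → con 1ℤ :* x :+ con 0ℤ := x) refl (f zero) ⟩
    f zero ∎
  sumF-δ (ℕ.suc n) (suc j) f = begin
    0# * f zero + sumF n (λ k → δ j k * f (suc k))
      ≡⟨ cong (0# * f zero +_) (sumF-δ n j (f ∘ suc)) ⟩
    0# * f zero + f (suc j)
      ≡⟨ solve 2 (λ x y → con 0ℤ :* x :+ y := y) refl (f zero) (f (suc j)) ⟩
    f (suc j) ∎

  ⊛-congˡ : ∀ {P Q : Mat d} (u : Vec d) → P ≈m Q → (P ⊛ u) ≈v (Q ⊛ u)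
  ⊛-congˡ {d} u P≈Q i = sumF-cong d (λ j → cong (_* u j) (P≈Q i j))

  ⊛-congʳ : ∀ (M : Mat d) {u v : Vec d} → u ≈v v → (M ⊛ u) ≈v (M ⊛ v)
  ⊛-congʳ {d} M u≈v i = sumF-cong d (λ j → cong (M i j *_) (u≈v j))

  ⊛-distribˡ-+v : ∀ (M : Mat d) u v → (M ⊛ (u +v v)) ≈v ((M ⊛ u) +v (M ⊛ v))
  ⊛-distribˡ-+v {d} M u v i =
    trans (sumF-cong d (λ j → distribˡ (M i j) (u j) (v j))) (sumF-+ d _ _)

  ⊛-distribʳ-+m : ∀ (P Q : Mat d) u → ((P +m Q) ⊛ u) ≈v ((P ⊛ u) +v (Q ⊛ u))
  ⊛-distribʳ-+m {d} P Q u i =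
    trans (sumF-cong d (λ j → distribʳ (u j) (P i j) (Q i j))) (sumF-+ d _ _)

  ⊛-neg : ∀ (M : Mat d) u → (M ⊛ (-v u)) ≈v (-v (M ⊛ u))
  ⊛-neg {d} M u i = trans (sumF-cong d (λ j → sym (-‿distribʳ-* (M i j) (u j)))) (sumF-neg d _)

  ⊛-−v : ∀ (M : Mat d) u v i → (M ⊛ (u −v v)) i ≡ (M ⊛ u) i - (M ⊛ v) i
  ⊛-−v M u v i = trans (⊛-distribˡ-+v M u (-v v) i) (cong ((M ⊛ u) i +_) (⊛-neg M v i))

  ⊛-·v : ∀ (M : Mat d) c u → (M ⊛ (c ·v u)) ≈v (c ·v (M ⊛ u))
  ⊛-·v {d} M c u i =
    trans (sumF-cong d (λ j → solve 3 (λ m c x → m :* (c :* x) := c :* (m :* x)) refl (M i j) c (u j)))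
          (sumF-*ˡ d c _)

  ·m-⊛ : ∀ c (M : Mat d) u → ((c ·m M) ⊛ u) ≈v (c ·v (M ⊛ u))
  ·m-⊛ {d} c M u i =
    trans (sumF-cong d (λ j → *-assoc c (M i j) (u j))) (sumF-*ˡ d c _)

  ·m-skew : ∀ c {S : Mat d} → IsSkew S → IsSkew (c ·m S)
  ·m-skew c {S} S-skew i j = trans (cong (c *_) (S-skew i j)) (sym (-‿distribʳ-* c (S i j)))

  dot-congʳ : ∀ (u : Vec d) {v w} → v ≈v w → dot u v ≡ dot u w
  dot-congʳ {d} u v≈w = sumF-cong d (λ i → cong (u i *_) (v≈w i))

  dot-⊛ : ∀ (u : Vec d) M v → dot u (M ⊛ v) ≡ sumF d (λ i → sumF d (λ j → u i * (M i j * v j)))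
  dot-⊛ {d} u M v = sumF-cong d (λ i → sym (sumF-*ˡ d (u i) _))

  dot-skew-self≡0 : ∀ {S : Mat d} → IsSkew S → ∀ u → dot u (S ⊛ u) ≡ 0#
  dot-skew-self≡0 {d} {S} S-skew u = x≡-x⇒x≡0 (begin
    dot u (S ⊛ u)                                           ≡⟨ dot-⊛ u S u ⟩
    sumF d (λ i → sumF d (λ j → u i * (S i j * u j)))       ≡⟨ sumF-comm d d _ ⟩
    sumF d (λ j → sumF d (λ i → u i * (S i j * u j)))       ≡⟨ sumF-cong d (sumF-cong d ∘ flip swap) ⟩
    sumF d (λ j → sumF d (λ i → - (u j * (S j i * u i))))   ≡⟨ sumF-cong d (λ j → sumF-neg d _) ⟩
    sumF d (λ j → - sumF d (λ i → u j * (S j i * u i)))     ≡⟨ sumF-neg d _ ⟩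
    - sumF d (λ j → sumF d (λ i → u j * (S j i * u i)))     ≡⟨ cong -_ (dot-⊛ u S u) ⟨
    - dot u (S ⊛ u)                                         ∎)
    where
    swap : ∀ i j → u i * (S i j * u j) ≡ - (u j * (S j i * u i))
    swap i j = trans (cong (λ s → u i * (s * u j)) (S-skew j i))
                     (solve 3 (λ a b s → a :* (:- s :* b) := :- (b :* (s :* a))) refl (u i) (u j) (S j i))

  dot-self≢0 : ∀ {u : Vec d} → ¬ (∀ i → u i ≡ 0#) → ¬ dot u u ≡ 0#
  dot-self≢0 {d} {u} u≢0 uu≡0 = ¬¬-pull-Fin d u²≡0⇒¬¬u≡0 u≢0
    where
    u²≡0⇒¬¬u≡0 : ∀ i → ¬ ¬ u i ≡ 0#
    u²≡0⇒¬¬u≡0 = x*x≡0⇒¬¬x≡0 ∘ sum-nonneg≡0 (0≤x*x ∘ u) (trans (sym (sumF≡sum d _)) uu≡0)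

  wedge : Fin d → Vec d → Mat d
  wedge j u a b = δ j a * u b - u a * δ j b

  wedge-skew : ∀ (j : Fin d) u → IsSkew (wedge j u)
  wedge-skew j u a b = solve 4 (λ p q r s → p :* q :- r :* s := :- (s :* r :- q :* p))
                               refl (δ j b) (u a) (u b) (δ j a)

  wedge-⊛ : ∀ (j : Fin d) u w a → (wedge j u ⊛ w) a ≡ δ j a * dot u w - u a * w j
  wedge-⊛ {d} j u w a = begin
    sumF d (λ b → (δ j a * u b - u a * δ j b) * w b)           ≡⟨ sumF-cong d expand ⟩
    sumF d (λ b → δ j a * (u b * w b) - u a * (δ j b * w b))  ≡⟨ sumF-linear d _ _ _ _ ⟩
    δ j a * dot u w - u a * sumF d (λ b → δ j b * w b)        ≡⟨ cong (λ t → δ j a * dot u w - u a * t) (sumF-δ d j w) ⟩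
    δ j a * dot u w - u a * w j                                ∎
    where
    expand : ∀ b → (δ j a * u b - u a * δ j b) * w b ≡ δ j a * (u b * w b) - u a * (δ j b * w b)
    expand b = solve 5 (λ p q r s t → (p :* q :- r :* s) :* t := p :* (q :* t) :- r :* (s :* t))
                       refl (δ j a) (u b) (u a) (δ j b) (w b)

  dot-wedge : ∀ (v : Vec d) j u w → dot v (wedge j u ⊛ w) ≡ dot u w * v j - w j * dot v u
  dot-wedge {d} v j u w = begin
    sumF d (λ a → v a * (wedge j u ⊛ w) a)                      ≡⟨ sumF-cong d (λ a → cong (v a *_) (wedge-⊛ j u w a)) ⟩
    sumF d (λ a → v a * (δ j a * dot u w - u a * w j))          ≡⟨ sumF-cong d expand ⟩
    sumF d (λ a → dot u w * (δ j a * v a) - w j * (v a * u a))  ≡⟨ sumF-linear d _ _ _ _ ⟩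
    dot u w * sumF d (λ a → δ j a * v a) - w j * dot v u        ≡⟨ cong (λ t → dot u w * t - w j * dot v u) (sumF-δ d j v) ⟩
    dot u w * v j - w j * dot v u                               ∎
    where
    expand : ∀ a → v a * (δ j a * dot u w - u a * w j) ≡ dot u w * (δ j a * v a) - w j * (v a * u a)
    expand a = solve 5 (λ v d p u w → v :* (d :* p :- u :* w) := p :* (d :* v) :- w :* (v :* u))
                       refl (v a) (δ j a) (dot u w) (u a) (w j)

  skew-orthogonal⇒parallel : ∀ {u w : Vec d} → (∀ S → IsSkew S → dot u (S ⊛ w) ≡ 0#) →
                             ∀ j → dot u w * u j ≡ w j * dot u u
  skew-orthogonal⇒parallel {u = u} {w} ⊥ j =
    x-y≡0⇒x≡y (trans (sym (dot-wedge u j u w)) (⊥ (wedge j u) (wedge-skew j u)))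

module Stabilisers (ℝ : RealField) where
  open RealField ℝ hiding (_≤_)
  open Euclid ℝ
  open RealFieldProperties ℝ
  open LinearAlgebra ℝ
  open CommutativeRing commutativeRing using (*-identityˡ)
  open import Algebra.Properties.Ring ring using (-‿+-comm; -‿injective)
  open ≡-Reasoning

  private variable d : ℕ

  𝔥-generator : ∀ {S : Mat d} (q : Vec d) → IsSkew S → 𝔥 q ⟦ S , -v (S ⊛ q) ⟧
  𝔥-generator q S-skew = _ , S-skew , (λ _ _ → refl) , (λ _ → refl)

  collinear⇒affine : ∀ {x y z : Vec d} → ¬ (y ≈v z) → Collinear x y z →
                     Σ Carrier λ t → x ≈v (((1# - t) ·v y) +v (t ·v z))
  collinear⇒affine {x = x} {y} {z} y≉z (p , v , a , b , c , x≈ , y≈ , z≈) = t , x≈affine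
    where
    c-b≢0 : ¬ c - b ≡ 0#
    c-b≢0 c-b≡0 = y≉z (λ i → trans (y≈ i) (trans (cong (λ s → p i + s * v i) b≡c) (sym (z≈ i))))
      where
      b≡c : b ≡ c
      b≡c = sym (x-y≡0⇒x≡y c-b≡0)
    t : Carrier
    t = (a - b) * inv (c - b) c-b≢0
    t[c-b]≡a-b : t * (c - b) ≡ a - b
    t[c-b]≡a-b = trans (solve 3 (λ x y z → x :* y :* z := x :* z :* y)
                              refl (a - b) (inv (c - b) c-b≢0) (c - b))
                       (x*y*y⁻¹≡x (a - b) c-b≢0)
    x≈affine : x ≈v (((1# - t) ·v y) +v (t ·v z))
    x≈affine i = begin
      x i                                               ≡⟨ x≈ i ⟩
      p i + a * v i                                     ≡⟨ cong (λ s → p i + s * v i) (x≡y+[x-y] a b) ⟩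
      p i + (b + (a - b)) * v i                         ≡⟨ cong (λ s → p i + (b + s) * v i) (sym t[c-b]≡a-b) ⟩
      p i + (b + t * (c - b)) * v i                     ≡⟨ regroup (p i) (v i) ⟩
      (1# - t) * (p i + b * v i) + t * (p i + c * v i)  ≡⟨ cong₂ (λ s r → (1# - t) * s + t * r) (y≈ i) (z≈ i) ⟨
      (1# - t) * y i + t * z i                          ∎
      where
      regroup : ∀ q e → q + (b + t * (c - b)) * e ≡ (1# - t) * (q + b * e) + t * (q + c * e)
      regroup = solve 5 (λ b c t q e → q :+ (b :+ t :* (c :- b)) :* e
                                       := (con 1ℤ :- t) :* (q :+ b :* e) :+ t :* (q :+ c :* e)) refl b c t

  affine⇒𝔥⊆⊕ : ∀ {x y z : Vec d} t → x ≈v (((1# - t) ·v y) +v (t ·v z)) →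
               𝔥 x ⊆ (𝔥 y ⊕ 𝔥 z)
  affine⇒𝔥⊆⊕ {x = x} {y} {z} t x≈ w (S , S-skew , S≈ , -Sx≈) =
    _ , _ , 𝔥-generator y (·m-skew (1# - t) S-skew) , 𝔥-generator z (·m-skew t S-skew) , blk≈ , col≈
    where
    blk≈ : blk w ≈m (((1# - t) ·m S) +m (t ·m S))
    blk≈ i j = trans (sym (S≈ i j)) (solve 2 (λ t s → s := (con 1ℤ :- t) :* s :+ t :* s) refl t (S i j))
    Sx≈ : ∀ i → (S ⊛ x) i ≡ (((1# - t) ·m S) ⊛ y) i + ((t ·m S) ⊛ z) i
    Sx≈ i = begin
      (S ⊛ x) i                                            ≡⟨ ⊛-congʳ S x≈ i ⟩
      (S ⊛ (((1# - t) ·v y) +v (t ·v z))) i                ≡⟨ ⊛-distribˡ-+v S _ _ i ⟩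
      (S ⊛ ((1# - t) ·v y)) i + (S ⊛ (t ·v z)) i
        ≡⟨ cong₂ _+_ (⊛-·v S (1# - t) y i) (⊛-·v S t z i) ⟩
      (1# - t) * (S ⊛ y) i + t * (S ⊛ z) i
        ≡⟨ cong₂ _+_ (·m-⊛ (1# - t) S y i) (·m-⊛ t S z i) ⟨
      (((1# - t) ·m S) ⊛ y) i + ((t ·m S) ⊛ z) i           ∎
    col≈ : col w ≈v ((-v (((1# - t) ·m S) ⊛ y)) +v (-v ((t ·m S) ⊛ z)))
    col≈ i = trans (sym (-Sx≈ i)) (trans (cong -_ (Sx≈ i)) (sym (-‿+-comm _ _)))

  -- S = S₁ + S₂ and S x = S₁ y + S₂ z give S (x − y) = S₂ (z − y).
  𝔥⊆⊕⇒skew-orthogonal : ∀ {x y z : Vec d} → 𝔥 x ⊆ (𝔥 y ⊕ 𝔥 z) →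
                        ∀ S → IsSkew S → dot (z −v y) (S ⊛ (x −v y)) ≡ 0#
  𝔥⊆⊕⇒skew-orthogonal {x = x} {y} {z} H S S-skew
    with H ⟦ S , -v (S ⊛ x) ⟧ (𝔥-generator x S-skew)
  ... | _ , _ , (S₁ , _ , S₁≈ , -S₁y≈) , (S₂ , S₂-skew , S₂≈ , -S₂z≈) , S≈ , -Sx≈ =
    trans (dot-congʳ (z −v y) Sw≈S₂u) (dot-skew-self≡0 S₂-skew (z −v y))
    where
    S≈S₁+S₂ : S ≈m (S₁ +m S₂)
    S≈S₁+S₂ i j = trans (S≈ i j) (sym (cong₂ _+_ (S₁≈ i j) (S₂≈ i j)))
    Sx≈ : ∀ i → (S ⊛ x) i ≡ (S₁ ⊛ y) i + (S₂ ⊛ z) i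
    Sx≈ i = -‿injective (trans (-Sx≈ i) (trans (sym (cong₂ _+_ (-S₁y≈ i) (-S₂z≈ i))) (-‿+-comm _ _)))
    Sw≈S₂u : (S ⊛ (x −v y)) ≈v (S₂ ⊛ (z −v y))
    Sw≈S₂u i = begin
      (S ⊛ (x −v y)) i                                     ≡⟨ ⊛-−v S x y i ⟩
      (S ⊛ x) i - (S ⊛ y) i
        ≡⟨ cong₂ _-_ (Sx≈ i) (trans (⊛-congˡ y S≈S₁+S₂ i) (⊛-distribʳ-+m S₁ S₂ y i)) ⟩
      ((S₁ ⊛ y) i + (S₂ ⊛ z) i) - ((S₁ ⊛ y) i + (S₂ ⊛ y) i)
        ≡⟨ solve 3 (λ a b c → (a :+ b) :- (a :+ c) := b :- c) refl ((S₁ ⊛ y) i) ((S₂ ⊛ z) i) ((S₂ ⊛ y) i) ⟩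
      (S₂ ⊛ z) i - (S₂ ⊛ y) i                              ≡⟨ ⊛-−v S₂ z y i ⟨
      (S₂ ⊛ (z −v y)) i                                    ∎

  𝔥⊆⊕⇒collinear : ∀ {x y z : Vec d} → ¬ (y ≈v z) → 𝔥 x ⊆ (𝔥 y ⊕ 𝔥 z) → Collinear x y z
  𝔥⊆⊕⇒collinear {x = x} {y} {z} y≉z H = y , u , a , 0# , 1# , x≈ , y≈ , z≈
    where
    u w : Vec _
    u = z −v y
    w = x −v y
    u≢0 : ¬ dot u u ≡ 0#
    u≢0 = dot-self≢0 (λ u≡0 → y≉z (λ i → sym (x-y≡0⇒x≡y (u≡0 i))))
    ⟨u,u⟩⁻¹ a : Carrier
    ⟨u,u⟩⁻¹ = inv (dot u u) u≢0
    a = dot u w * ⟨u,u⟩⁻¹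
    parallel : ∀ i → dot u w * u i ≡ w i * dot u u
    parallel = skew-orthogonal⇒parallel (𝔥⊆⊕⇒skew-orthogonal H)
    x≈ : ∀ i → x i ≡ y i + a * u i
    x≈ i = begin
      x i                            ≡⟨ x≡y+[x-y] (x i) (y i) ⟩
      y i + w i                      ≡⟨ cong (y i +_) (x*y*y⁻¹≡x (w i) u≢0) ⟨
      y i + w i * dot u u * ⟨u,u⟩⁻¹  ≡⟨ cong (λ s → y i + s * ⟨u,u⟩⁻¹) (parallel i) ⟨
      y i + dot u w * u i * ⟨u,u⟩⁻¹  ≡⟨ cong (y i +_) (solve 3 (λ p q r → p :* q :* r := p :* r :* q)
                                                             refl (dot u w) (u i) ⟨u,u⟩⁻¹) ⟩
      y i + a * u i                  ∎
    y≈ : ∀ i → y i ≡ y i + 0# * u i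
    y≈ i = solve 2 (λ y u → y := y :+ con 0ℤ :* u) refl (y i) (u i)
    z≈ : ∀ i → z i ≡ y i + 1# * u i
    z≈ i = trans (x≡y+[x-y] (z i) (y i)) (cong (y i +_) (sym (*-identityˡ (u i))))

mainTheorem17 : (ℝ : RealField) → let open Euclid ℝ in
    (d : ℕ) → 2 ≤ d → (x y z : Vec d) →
    ¬ (x ≈v y) → ¬ (y ≈v z) → ¬ (x ≈v z) →
    Collinear x y z ⇔ (𝔥 x ⊆ (𝔥 y ⊕ 𝔥 z))
mainTheorem17 ℝ d _ x y z _ y≉z _ =
  mk⇔ (λ collinear → let t , x≈ = collinear⇒affine y≉z collinear in affine⇒𝔥⊆⊕ t x≈)
      (𝔥⊆⊕⇒collinear y≉z)
  where open Stabilisers ℝ
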